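{- Let $n\ge 1$ and $A=\{1,n\}$. (1) If $n$ is odd, the P-positions of $SN(n,A)$ are exactly the positions $\mathbf p$ with $\Sigma(\mathbf p)$ even. (2) If $n$ is even, the P-positions of $SN(n,A)$ are exactly the positions $\mathbf p$ with $\Sigma(\mathbf p)$ even and $p_1$ even, where $p_1=\min_i p_i$.
   Context: The game $SN(n,A)$, for nonempty $A\subseteq\{1,\dots,n\}$, is played on $n$ stacks of tokens; a position is $\mathbf p=(p_1,\dots,p_n)$ of nonnegative integers written in non-decreasing order (so $p_1$ is a minimal stack height). A move consists of choosing some $\ell\in A$ and $\ell$ distinct stacks, each of height at least $1$, and removing exactly one token from each. Players alternate; a player unable to move loses (normal play). A P-position is one from which the player to move loses under optimal play. $\Sigma(\mathbf p)=\sum_i p_i$. -}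

module Defs where

open import Data.Nat using (ℕ; suc; _≤_; pred; _⊓_)
open import Data.Fin using (Fin)
open import Data.Fin.Subset using (Subset; _∈_; _∉_; ∣_∣)
open import Data.Vec using (Vec; lookup; sum; foldr₁)
open import Data.Product using (Σ; _×_)
open import Relation.Binary.PropositionalEquality using (_≡_)
open import Data.Sum using (_⊎_)

Position : ℕ → Set
Position n = Vec ℕ n

Σp : ∀ {n} → Position n → ℕ
Σp = sum

-- minimal stack height (= p₁ when p is written in non-decreasing order)
minHeight : ∀ {n} → Position (suc n) → ℕ
minHeight = foldr₁ _⊓_

Move : ∀ {n} → (A : ℕ → Set) → Position n → Position n → Set
Move {n} A p q =
  Σ (Subset n) λ S →
    A ∣ S ∣ ×
    (∀ i → i ∈ S → 1 ≤ lookup p i) ×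
    (∀ i → i ∈ S → lookup q i ≡ pred (lookup p i)) ×
    (∀ i → i ∉ S → lookup q i ≡ lookup p i)

mutual
  data IsP {n} (A : ℕ → Set) (p : Position n) : Set where
    allToN : (∀ q → Move A p q → IsN A q) → IsP A p

  data IsN {n} (A : ℕ → Set) (p : Position n) : Set where
    someToP : (q : Position n) → Move A p q → IsP A q → IsN A p

A1n : ℕ → ℕ → Set
A1n n ℓ = ℓ ≡ 1 ⊎ ℓ ≡ n

-- A position is a P-position iff it lies in a set G such that no move leads
-- from G to G and every position outside G has a move into G (induction on the
-- number of tokens). For n odd every move removes an odd number of tokens, so
-- G = {even Σ} works. For n even a full move keeps the parity of Σ but flips
-- the parity of the minimum, while a single move flips the parity of Σ and
-- leaves the minimum's parity unchanged, except when taken from a minimal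
-- stack; this makes G = {even Σ, even p₁} work, the one delicate case being
-- Σ odd with p₁ even: there some stack exceeds the minimum (otherwise
-- Σ = n p₁ would be even) and one removes a token from it.
module Submission where

open import Defs
open import Data.Nat using (ℕ; zero; suc; z≤n; _+_; _*_; _≤_; _<_; s≤s; pred; _≤?_; _<?_)
open import Data.Nat.Properties
  using (+-comm; +-suc; +-assoc; m<m+n; ≤-refl; ≤-trans; ≤-reflexive; ≤-antisym; <-irrefl; ≮⇒≥;
         n≤0⇒n≡0; m⊓n≤m; m⊓n≤n; ⊓-sel; pred-mono-≤; pred[n]≤n; <⇒≤pred)
open import Data.Nat.Induction using (<-wellFounded)
open import Data.Nat.Divisibility using (_∣_; _∤_; _∣?_; divides; ∣-refl; ∣m∣n⇒∣m+n; >⇒∤; ∣m+n∣m⇒∣n; ∣m⇒∣m*n; ∣n⇒∣m*n)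
open import Data.Fin using (_≟_) renaming (zero to fzero; suc to fsuc)
open import Data.Fin.Properties using (any?)
open import Data.Fin.Subset using (Subset; _∈_; _∉_; ∣_∣; ⁅_⁆; ⊤; inside; outside)
open import Data.Fin.Subset.Properties using (∈⊤; ∣⊤∣≡n; ∣p∣≡n⇒p≡⊤; x∈⁅x⁆; x∈⁅y⁆⇒x≡y; ∣⁅x⁆∣≡1)
open import Data.Vec using ([]; _∷_; lookup; map; updateAt; here; there)
open import Data.Vec.Properties using (lookup∘updateAt; lookup∘updateAt′; lookup-map)
open import Data.Product using (_×_; _,_; proj₁; proj₂; ∃-syntax)
open import Data.Sum using (inj₁; inj₂)
open import Function.Base using (_∘_)
open import Function.Bundles using (_⇔_; mk⇔)
open import Induction.WellFounded using (Acc; acc)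
open import Relation.Nullary using (¬_; yes; no; contradiction)
open import Relation.Nullary.Decidable using (_×-dec_)
open import Relation.Unary using (Decidable)
open import Relation.Binary.PropositionalEquality
  using (_≡_; _≢_; refl; sym; trans; cong; cong₂; subst; module ≡-Reasoning)

2∤1 : 2 ∤ 1
2∤1 = >⇒∤ ≤-refl

2∣n⇒2∤1+n : ∀ {n} → 2 ∣ n → 2 ∤ suc n
2∣n⇒2∤1+n {n} 2∣n 2∣1+n = 2∤1 (∣m+n∣m⇒∣n (subst (2 ∣_) (+-comm 1 n) 2∣1+n) 2∣n)

2∤1+n⇒2∣n : ∀ n → 2 ∤ suc n → 2 ∣ n
2∤1+n⇒2∣n zero          _     = divides 0 refl
2∤1+n⇒2∣n (suc zero)    2∤2   = contradiction ∣-refl 2∤2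
2∤1+n⇒2∣n (suc (suc n)) 2∤3+n = ∣m∣n⇒∣m+n ∣-refl (2∤1+n⇒2∣n n (2∤3+n ∘ ∣m∣n⇒∣m+n ∣-refl))

2∤n⇒1≤n : ∀ {n} → 2 ∤ n → 1 ≤ n
2∤n⇒1≤n {zero}  2∤0 = contradiction (divides 0 refl) 2∤0
2∤n⇒1≤n {suc n} _   = s≤s z≤n

2∣n⇒2∤pred[n] : ∀ {n} → 1 ≤ n → 2 ∣ n → 2 ∤ pred n
2∣n⇒2∤pred[n] (s≤s _) 2∣1+n 2∣n = 2∣n⇒2∤1+n 2∣n 2∣1+n

2∤n⇒2∣pred[n] : ∀ {n} → 2 ∤ n → 2 ∣ pred n
2∤n⇒2∣pred[n] {zero}  2∤0   = contradiction (divides 0 refl) 2∤0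
2∤n⇒2∣pred[n] {suc n} 2∤1+n = 2∤1+n⇒2∣n n 2∤1+n

IsP⇒¬IsN : ∀ {n A} {p : Position n} → IsP A p → ¬ IsN A p
IsP⇒¬IsN (allToN toN) (someToP q p→q qP) = IsP⇒¬IsN qP (toN q p→q)

IsKernel : ∀ {n} → (ℕ → Set) → (Position n → Set) → Set
IsKernel A G =
  (∀ {p q} → G p → Move A p q → ¬ G q) ×
  (∀ {p} → ¬ G p → ∃[ q ] Move A p q × G q)

Removes : ∀ {n} → Subset n → Position n → Position n → Set
Removes S p q =
  (∀ i → i ∈ S → 1 ≤ lookup p i) ×
  (∀ i → i ∈ S → lookup q i ≡ pred (lookup p i)) ×
  (∀ i → i ∉ S → lookup q i ≡ lookup p i)

Removes-tail : ∀ {n b x y} {S : Subset n} {p q} → Removes (b ∷ S) (x ∷ p) (y ∷ q) → Removes S p q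
Removes-tail (nonempty , removed , kept) =
  (λ i i∈S → nonempty (fsuc i) (there i∈S)) ,
  (λ i i∈S → removed (fsuc i) (there i∈S)) ,
  (λ { i i∉S → kept (fsuc i) (λ { (there i∈S) → i∉S i∈S }) })

Σp-Removes : ∀ {n} {S : Subset n} {p q} → Removes S p q → Σp q + ∣ S ∣ ≡ Σp p
Σp-Removes {S = []} {[]} {[]} _ = refl
Σp-Removes {S = inside ∷ S} {suc x ∷ p} {y ∷ q} r@(_ , removed , _) = begin
    y + Σp q + suc ∣ S ∣     ≡⟨ cong (λ z → z + Σp q + suc ∣ S ∣) (removed fzero here) ⟩
    x + Σp q + suc ∣ S ∣     ≡⟨ +-suc (x + Σp q) ∣ S ∣ ⟩
    suc (x + Σp q + ∣ S ∣)   ≡⟨ cong suc (+-assoc x (Σp q) ∣ S ∣) ⟩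
    suc (x + (Σp q + ∣ S ∣)) ≡⟨ cong (λ k → suc (x + k)) (Σp-Removes {p = p} {q} (Removes-tail r)) ⟩
    suc (x + Σp p)           ∎
  where open ≡-Reasoning
Σp-Removes {S = inside ∷ S} {zero ∷ p} {y ∷ q} (nonempty , _) with nonempty fzero here
... | ()
Σp-Removes {S = outside ∷ S} {x ∷ p} {y ∷ q} r@(_ , _ , kept) = begin
  y + Σp q + ∣ S ∣   ≡⟨ cong (λ z → z + Σp q + ∣ S ∣) (kept fzero (λ ())) ⟩
  x + Σp q + ∣ S ∣   ≡⟨ +-assoc x (Σp q) ∣ S ∣ ⟩
  x + (Σp q + ∣ S ∣) ≡⟨ cong (x +_) (Σp-Removes {p = p} {q} (Removes-tail r)) ⟩
  x + Σp p           ∎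
  where open ≡-Reasoning

Move⇒Σp< : ∀ {n A} {p q : Position n} → (∀ {ℓ} → A ℓ → 1 ≤ ℓ) → Move A p q → Σp q < Σp p
Move⇒Σp< {p = p} {q} positive (S , A∣S∣ , r) =
  subst (Σp q <_) (Σp-Removes {p = p} {q} r) (m<m+n (Σp q) (positive A∣S∣))

IsP⇔kernel : ∀ {n A} {G : Position n → Set} → (∀ {ℓ} → A ℓ → 1 ≤ ℓ) →
             Decidable G → IsKernel A G → ∀ p → IsP A p ⇔ G p
IsP⇔kernel {A = A} {G} positive G? (independent , absorbing) p =
  mk⇔ IsP⇒G (G⇒IsP p (<-wellFounded (Σp p)))
  where
  G⇒IsP  : ∀ p → Acc _<_ (Σp p) → G p → IsP A p
  ¬G⇒IsN : ∀ p → Acc _<_ (Σp p) → ¬ G p → IsN A p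
  G⇒IsP p (acc smaller) Gp = allToN λ q p→q →
    ¬G⇒IsN q (smaller (Move⇒Σp< {p = p} {q} positive p→q)) (independent Gp p→q)
  ¬G⇒IsN p (acc smaller) ¬Gp with absorbing ¬Gp
  ... | q , p→q , Gq = someToP q p→q (G⇒IsP q (smaller (Move⇒Σp< {p = p} {q} positive p→q)) Gq)

  IsP⇒G : IsP A p → G p
  IsP⇒G pP with G? p
  ... | yes Gp = Gp
  ... | no ¬Gp = contradiction (¬G⇒IsN p (<-wellFounded (Σp p)) ¬Gp) (IsP⇒¬IsN pP)

Σp-const : ∀ {n} (p : Position n) {c} → (∀ i → lookup p i ≡ c) → Σp p ≡ n * c
Σp-const []      _      = refl
Σp-const (x ∷ p) all≡c = cong₂ _+_ (all≡c fzero) (Σp-const p (all≡c ∘ fsuc))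

removeOne-Removes : ∀ {n} (p : Position n) {j} → 1 ≤ lookup p j → Removes ⁅ j ⁆ p (updateAt p j pred)
removeOne-Removes p {j} 1≤pⱼ = nonempty , removed , kept
  where
  nonempty : ∀ i → i ∈ ⁅ j ⁆ → 1 ≤ lookup p i
  nonempty i i∈⁅j⁆ rewrite x∈⁅y⁆⇒x≡y j i∈⁅j⁆ = 1≤pⱼ
  removed : ∀ i → i ∈ ⁅ j ⁆ → lookup (updateAt p j pred) i ≡ pred (lookup p i)
  removed i i∈⁅j⁆ rewrite x∈⁅y⁆⇒x≡y j i∈⁅j⁆ = lookup∘updateAt j p
  kept : ∀ i → i ∉ ⁅ j ⁆ → lookup (updateAt p j pred) i ≡ lookup p i
  kept i i∉⁅j⁆ = lookup∘updateAt′ i j (λ { refl → i∉⁅j⁆ (x∈⁅x⁆ j) }) p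

removeOne : ∀ {n A} (p : Position n) {j} → A 1 → 1 ≤ lookup p j → Move A p (updateAt p j pred)
removeOne {A = A} p {j} A1 1≤pⱼ = ⁅ j ⁆ , subst A (sym (∣⁅x⁆∣≡1 j)) A1 , removeOne-Removes p 1≤pⱼ

Σp-removeOne : ∀ {n} (p : Position n) {j} → 1 ≤ lookup p j → suc (Σp (updateAt p j pred)) ≡ Σp p
Σp-removeOne p {j} 1≤pⱼ = begin
  suc (Σp q)          ≡⟨ +-comm 1 (Σp q) ⟩
  Σp q + 1            ≡⟨ cong (Σp q +_) (∣⁅x⁆∣≡1 j) ⟨
  Σp q + ∣ ⁅ j ⁆ ∣    ≡⟨ Σp-Removes {p = p} {q} (removeOne-Removes p 1≤pⱼ) ⟩
  Σp p                ∎
  where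
  open ≡-Reasoning
  q = updateAt p j pred

Removes-odd⇒2∤Σp : ∀ {n} {S : Subset n} {p q} → Removes S p q → 2 ∤ ∣ S ∣ → 2 ∣ Σp p → 2 ∤ Σp q
Removes-odd⇒2∤Σp {p = p} {q} r 2∤∣S∣ 2∣Σp 2∣Σq =
  2∤∣S∣ (∣m+n∣m⇒∣n (subst (2 ∣_) (sym (Σp-Removes {p = p} {q} r)) 2∣Σp) 2∣Σq)

removeOne-2∣Σp : ∀ {n} (p : Position n) {j} → 1 ≤ lookup p j → 2 ∤ Σp p → 2 ∣ Σp (updateAt p j pred)
removeOne-2∣Σp p 1≤pⱼ 2∤Σp = 2∤1+n⇒2∣n _ (subst (2 ∤_) (sym (Σp-removeOne p 1≤pⱼ)) 2∤Σp)

removeAll-Removes : ∀ {n} (p : Position n) → (∀ i → 1 ≤ lookup p i) → Removes ⊤ p (map pred p)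
removeAll-Removes p nonempty =
  (λ i _ → nonempty i) , (λ i _ → lookup-map i pred p) , (λ i i∉⊤ → contradiction ∈⊤ i∉⊤)

removeAll : ∀ {n A} (p : Position n) → A n → (∀ i → 1 ≤ lookup p i) → Move A p (map pred p)
removeAll {n} {A} p An nonempty = ⊤ , subst A (sym (∣⊤∣≡n n)) An , removeAll-Removes p nonempty

Σp-removeAll : ∀ {n} (p : Position n) → (∀ i → 1 ≤ lookup p i) → Σp (map pred p) + n ≡ Σp p
Σp-removeAll {n} p nonempty =
  subst (λ k → Σp (map pred p) + k ≡ Σp p) (∣⊤∣≡n n)
        (Σp-Removes {p = p} {map pred p} (removeAll-Removes p nonempty))

Removes-all : ∀ {n} {S : Subset n} {p q} → Removes S p q → ∣ S ∣ ≡ n →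
              ∀ i → 1 ≤ lookup p i × lookup q i ≡ pred (lookup p i)
Removes-all (nonempty , removed , _) ∣S∣≡n i = nonempty i i∈S , removed i i∈S
  where
  i∈S : i ∈ _
  i∈S = subst (i ∈_) (sym (∣p∣≡n⇒p≡⊤ ∣S∣≡n)) ∈⊤

minHeight≤ : ∀ {n} (p : Position (suc n)) i → minHeight p ≤ lookup p i
minHeight≤ (x ∷ [])     fzero    = ≤-refl
minHeight≤ (x ∷ y ∷ p) fzero    = m⊓n≤m x _
minHeight≤ (x ∷ y ∷ p) (fsuc i) = ≤-trans (m⊓n≤n x _) (minHeight≤ (y ∷ p) i)

minHeight-attained : ∀ {n} (p : Position (suc n)) → ∃[ i ] lookup p i ≡ minHeight p
minHeight-attained (x ∷ []) = fzero , refl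
minHeight-attained (x ∷ y ∷ p) with ⊓-sel x (minHeight (y ∷ p))
... | inj₁ x⊓m≡x = fzero , sym x⊓m≡x
... | inj₂ x⊓m≡m with minHeight-attained (y ∷ p)
...   | i , attained = fsuc i , trans attained (sym x⊓m≡m)

minHeight-unique : ∀ {n} (p : Position (suc n)) {c j} →
                   (∀ i → c ≤ lookup p i) → lookup p j ≡ c → minHeight p ≡ c
minHeight-unique p {j = j} lower pⱼ≡c with minHeight-attained p
... | i , pᵢ≡min = ≤-antisym (subst (minHeight p ≤_) pⱼ≡c (minHeight≤ p j))
                            (subst (_ ≤_) pᵢ≡min (lower i))

minHeight-pred : ∀ {n} (p q : Position (suc n)) → (∀ i → lookup q i ≡ pred (lookup p i)) →
                 minHeight q ≡ pred (minHeight p)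
minHeight-pred p q q≡pred-p with minHeight-attained p
... | j , pⱼ≡min = minHeight-unique q
  (λ i → subst (pred (minHeight p) ≤_) (sym (q≡pred-p i)) (pred-mono-≤ (minHeight≤ p i)))
  (trans (q≡pred-p j) (cong pred pⱼ≡min))

pred≤lookup-updateAt : ∀ {n} (p : Position n) j i → pred (lookup p i) ≤ lookup (updateAt p j pred) i
pred≤lookup-updateAt p j i with i ≟ j
... | yes refl = ≤-reflexive (sym (lookup∘updateAt j p))
... | no i≢j   = subst (pred (lookup p i) ≤_) (sym (lookup∘updateAt′ i j i≢j p)) pred[n]≤n

minHeight-removeMin : ∀ {n} (p : Position (suc n)) {j} → lookup p j ≡ minHeight p →
                      minHeight (updateAt p j pred) ≡ pred (minHeight p)
minHeight-removeMin p {j} pⱼ≡min = minHeight-unique (updateAt p j pred)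
  (λ i → ≤-trans (pred-mono-≤ (minHeight≤ p i)) (pred≤lookup-updateAt p j i))
  (trans (lookup∘updateAt j p) (cong pred pⱼ≡min))

minHeight-removeAbove : ∀ {n} (p : Position (suc n)) {j} → minHeight p < lookup p j →
                        minHeight (updateAt p j pred) ≡ minHeight p
minHeight-removeAbove p {j} min<pⱼ with minHeight-attained p
... | i₀ , pᵢ₀≡min = minHeight-unique (updateAt p j pred) lower
  (trans (lookup∘updateAt′ i₀ j i₀≢j p) pᵢ₀≡min)
  where
  i₀≢j : i₀ ≢ j
  i₀≢j refl = <-irrefl (sym pᵢ₀≡min) min<pⱼ
  lower : ∀ i → minHeight p ≤ lookup (updateAt p j pred) i
  lower i with i ≟ j
  ... | yes refl = subst (minHeight p ≤_) (sym (lookup∘updateAt j p)) (<⇒≤pred min<pⱼ)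
  ... | no i≢j   = subst (minHeight p ≤_) (sym (lookup∘updateAt′ i j i≢j p)) (minHeight≤ p i)

oddMoves-kernel : ∀ {n A} → (∀ {ℓ} → A ℓ → 2 ∤ ℓ) → A 1 → IsKernel {n} A (λ p → 2 ∣ Σp p)
oddMoves-kernel {n} {A} odd A1 = (λ {p} {q} → independent {p} {q}) , (λ {p} → absorbing {p})
  where
  independent : ∀ {p q} → 2 ∣ Σp p → Move A p q → 2 ∤ Σp q
  independent {p} {q} 2∣Σp (S , A∣S∣ , r) = Removes-odd⇒2∤Σp {p = p} {q} r (odd A∣S∣) 2∣Σp

  absorbing : ∀ {p} → 2 ∤ Σp p → ∃[ q ] Move A p q × 2 ∣ Σp q
  absorbing {p} 2∤Σp with any? (λ j → 1 ≤? lookup p j)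
  ... | yes (j , 1≤pⱼ) = updateAt p j pred , removeOne {A = A} p A1 1≤pⱼ ,
    removeOne-2∣Σp p 1≤pⱼ 2∤Σp
  ... | no noneNonempty = contradiction (subst (2 ∣_) (sym Σp≡n*0) (∣n⇒∣m*n n (divides 0 refl))) 2∤Σp
    where
    Σp≡n*0 : Σp p ≡ n * 0
    Σp≡n*0 = Σp-const p (λ i → n≤0⇒n≡0 (≮⇒≥ (λ 1≤pᵢ → noneNonempty (i , 1≤pᵢ))))

P-positions-oddMoves : ∀ {n A} → (∀ {ℓ} → A ℓ → 2 ∤ ℓ) → A 1 →
                       ∀ (p : Position n) → IsP A p ⇔ 2 ∣ Σp p
P-positions-oddMoves odd A1 =
  IsP⇔kernel (2∤n⇒1≤n ∘ odd) (λ p → 2 ∣? Σp p) (oddMoves-kernel odd A1)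

EvenΣpAndMin : ∀ {n} → Position (suc n) → Set
EvenΣpAndMin p = (2 ∣ Σp p) × (2 ∣ minHeight p)

A1n-even-kernel : ∀ {m} → 2 ∣ suc m → IsKernel (A1n (suc m)) (EvenΣpAndMin {m})
A1n-even-kernel {m} 2∣n = (λ {p} {q} → independent {p} {q}) , (λ {p} → absorbing {p})
  where
  A = A1n (suc m)

  independent : ∀ {p q} → EvenΣpAndMin p → Move A p q → ¬ EvenΣpAndMin q
  independent {p} {q} (2∣Σp , _) (S , inj₁ ∣S∣≡1 , r) (2∣Σq , _) =
    Removes-odd⇒2∤Σp {p = p} {q} r (subst (2 ∤_) (sym ∣S∣≡1) 2∤1) 2∣Σp 2∣Σq
  independent {p} {q} (_ , 2∣min) (S , inj₂ ∣S∣≡n , r) (_ , 2∣minq) with minHeight-attained p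
  ... | j , pⱼ≡min = 2∣n⇒2∤pred[n] 1≤min 2∣min (subst (2 ∣_) min-q≡pred-min 2∣minq)
    where
    full : ∀ i → 1 ≤ lookup p i × lookup q i ≡ pred (lookup p i)
    full = Removes-all {p = p} {q} r ∣S∣≡n
    1≤min : 1 ≤ minHeight p
    1≤min = subst (1 ≤_) pⱼ≡min (proj₁ (full j))
    min-q≡pred-min : minHeight q ≡ pred (minHeight p)
    min-q≡pred-min = minHeight-pred p q (proj₂ ∘ full)

  absorbing : ∀ {p} → ¬ EvenΣpAndMin p → ∃[ q ] Move A p q × EvenΣpAndMin q
  absorbing {p} ¬G with 2 ∣? Σp p | 2 ∣? minHeight p
  ... | yes 2∣Σp | yes 2∣min = contradiction (2∣Σp , 2∣min) ¬G
  ... | no 2∤Σp  | no 2∤min with minHeight-attained p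
  ...   | j , pⱼ≡min = updateAt p j pred , removeOne {A = A} p (inj₁ refl) 1≤pⱼ ,
          removeOne-2∣Σp p 1≤pⱼ 2∤Σp ,
          subst (2 ∣_) (sym (minHeight-removeMin p pⱼ≡min)) (2∤n⇒2∣pred[n] 2∤min)
    where
    1≤pⱼ : 1 ≤ lookup p j
    1≤pⱼ = subst (1 ≤_) (sym pⱼ≡min) (2∤n⇒1≤n 2∤min)
  absorbing {p} ¬G | no 2∤Σp | yes 2∣min with any? (λ j → minHeight p <? lookup p j)
  ... | yes (j , min<pⱼ) = updateAt p j pred , removeOne {A = A} p (inj₁ refl) 1≤pⱼ ,
          removeOne-2∣Σp p 1≤pⱼ 2∤Σp ,
          subst (2 ∣_) (sym (minHeight-removeAbove p min<pⱼ)) 2∣min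
    where
    1≤pⱼ : 1 ≤ lookup p j
    1≤pⱼ = ≤-trans (s≤s z≤n) min<pⱼ
  ... | no noneAbove = contradiction (subst (2 ∣_) (sym Σp≡n*min) (∣m⇒∣m*n (minHeight p) 2∣n)) 2∤Σp
    where
    Σp≡n*min : Σp p ≡ suc m * minHeight p
    Σp≡n*min = Σp-const p (λ i → ≤-antisym (≮⇒≥ (λ min<pᵢ → noneAbove (i , min<pᵢ))) (minHeight≤ p i))
  absorbing {p} ¬G | yes 2∣Σp | no 2∤min =
    map pred p , removeAll {A = A} p (inj₂ refl) nonempty ,
    ∣m+n∣m⇒∣n (subst (2 ∣_) (sym (trans (+-comm (suc m) _) (Σp-removeAll p nonempty))) 2∣Σp) 2∣n ,
    subst (2 ∣_) (sym (minHeight-pred p (map pred p) (λ i → lookup-map i pred p))) (2∤n⇒2∣pred[n] 2∤min)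
    where
    nonempty : ∀ i → 1 ≤ lookup p i
    nonempty i = ≤-trans (2∤n⇒1≤n 2∤min) (minHeight≤ p i)

P-positions-A1n-even : ∀ {m} → 2 ∣ suc m →
                       ∀ (p : Position (suc m)) → IsP (A1n (suc m)) p ⇔ EvenΣpAndMin p
P-positions-A1n-even {m} 2∣n =
  IsP⇔kernel A1n-positive (λ p → (2 ∣? Σp p) ×-dec (2 ∣? minHeight p)) (A1n-even-kernel 2∣n)
  where
  A1n-positive : ∀ {ℓ} → A1n (suc m) ℓ → 1 ≤ ℓ
  A1n-positive (inj₁ refl) = s≤s z≤n
  A1n-positive (inj₂ refl) = s≤s z≤n

theorem7 : (m : ℕ) →
    ((¬ (2 ∣ suc m)) → (p : Position (suc m)) →
      IsP (A1n (suc m)) p ⇔ (2 ∣ Σp p))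
    ×
    ((2 ∣ suc m) → (p : Position (suc m)) →
      IsP (A1n (suc m)) p ⇔ ((2 ∣ Σp p) × (2 ∣ minHeight p)))
theorem7 m = (λ 2∤n → P-positions-oddMoves (A1n-odd 2∤n) (inj₁ refl)) , P-positions-A1n-even
  where
  A1n-odd : 2 ∤ suc m → ∀ {ℓ} → A1n (suc m) ℓ → 2 ∤ ℓ
  A1n-odd _   (inj₁ refl) = 2∤1
  A1n-odd 2∤n (inj₂ refl) = 2∤n
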